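{- Let $n\geq 2$. Then \[ \max_{S \in S_2,\ (R,C)=\operatorname{E}_2(S)} \frac{C}{R} = 2 . \] In other words, for every valid input $S$ of $\operatorname{E}_2$ the number $C$ of cases checked satisfies $C \le 2|S|$, and equality is attained for some valid input.
   Context: For a positive integer $\ell$, the pruning function $\operatorname{P}_{\ell}:\mathbb{Z}_{>0}\to\mathbb{Z}_{\geq 0}$ is defined as follows: write $m$ in binary, padded on the left with zeros as needed, and let $z$ be the position (position $0$ being the least significant bit) of the $\ell$-th zero bit counted from the right. Let $q = 2^{z}\lfloor m/2^{z}\rfloor$ (i.e. $m$ with all bits to the right of that zero set to $0$). Then $\operatorname{P}_{\ell}(m) = \max(q-1,0)$. (E.g. $\operatorname{P}_1(23)=15$, $\operatorname{P}_2(23)=0$.) The efficiency algorithm $\operatorname{E}_{\ell}$ (for given integers $n\ge 2$, $\ell>0$) takes as input a nonempty $S\subseteq\{1,\ldots,2^n-1\}$ and outputs a pair $(R,C)$: initialize $j\leftarrow 2^n-1$, $R\leftarrow 0$, $C\leftarrow 0$; while $j>0$: set $C\leftarrow C+1$; if $j\in S$ then $R\leftarrow R+1$ and $j\leftarrow j-1$; otherwise $j\leftarrow \operatorname{P}_{\ell}(j)$. Return $(R,C)$. An input $S$ is called valid if the output satisfies $R=|S|$; $S_{\ell}$ denotes the set of all valid inputs (for the given $n$ and $\ell$). Here $\ell=2$. -}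

module Defs where

open import Data.Nat using (ℕ; zero; suc; _+_; _*_; _∸_; _^_; _≡ᵇ_)
open import Data.Nat.Properties using (m^n≢0)
open import Data.Nat.DivMod using (_/_; _%_)
open import Data.Bool using (Bool; true; false; if_then_else_)
open import Data.Product using (_×_; _,_)
open import Data.Vec using (Vec; []; _∷_)
open import Data.Fin.Subset using (Subset; inside; outside)

-- Position (0 = least significant bit) of the ℓ-th zero bit (counted from
-- the right) of m, for ℓ ≥ 1.  The first argument is fuel; with fuel
-- m + ℓ + 1 the search never runs out (each step either halves m or
-- consumes one of the ℓ zeros).
zeroPosF : ℕ → ℕ → ℕ → ℕ
zeroPosF zero    ℓ m = 0
zeroPosF (suc f) ℓ m with m % 2 ≡ᵇ 1
... | true  = suc (zeroPosF f ℓ (m / 2))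
... | false with ℓ
...   | zero        = 0
...   | suc zero    = 0
...   | suc (suc k) = suc (zeroPosF f (suc k) (m / 2))

zeroPos : ℕ → ℕ → ℕ
zeroPos ℓ m = zeroPosF (suc (m + ℓ)) ℓ m

prune : ℕ → ℕ → ℕ
prune ℓ m = (2 ^ z * ((m / 2 ^ z) {{m^n≢0 2 z}})) ∸ 1
  where z = zeroPos ℓ m

memB : ∀ {k} → Subset k → ℕ → Bool
memB []             _       = false
memB (b ∷ _)        zero    = b
memB (_ ∷ v)        (suc j) = memB v j

loop : ∀ {k} → ℕ → ℕ → Subset k → ℕ → ℕ → ℕ → ℕ × ℕ
loop zero    ℓ S j       R C = R , C
loop (suc f) ℓ S zero    R C = R , C
loop (suc f) ℓ S (suc j) R C =
  if memB S (suc j)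
  then loop f ℓ S j (suc R) (suc C)
  else loop f ℓ S (prune ℓ (suc j)) R (suc C)

-- Efficiency algorithm E_ℓ on S ⊆ {1,…,2^n - 1}, represented as a subset of
-- Fin (2^n) not containing 0.  j strictly decreases in each iteration, so the
-- fuel 2^n is never exhausted.
E : (n ℓ : ℕ) → Subset (2 ^ n) → ℕ × ℕ
E n ℓ S = loop (2 ^ n) ℓ S (2 ^ n ∸ 1) 0 0

{-# OPTIONS --safe #-}
-- Let z(m) be the number of zero digits of m below its leading one, and let Φ(0) = 0 and
-- Φ(j) = max(1, z(j)) for j > 0.  A hit j ↦ j - 1 raises Φ by at most one, while a pruning
-- step j ↦ P₂(j) = q - 1 lowers it by at least one: in q - 1 the two lowest zeros of j have
-- become ones and the borrow creates at most one new zero.  Hence every run from j satisfies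
-- C ≤ 2R + Φ(j).  A run from 2ⁿ - 1 with R > 0 must start with a hit (a pruning step would
-- go straight to 0), after which it continues from 2ⁿ - 2, where Φ = 1; so C ≤ 2R.  The
-- singleton {2ⁿ - 1} is valid and attains C = 2 = 2R.
module Submission where

open import Defs
open import Data.Nat using (ℕ; zero; suc; _+_; _*_; _∸_; _^_; _≤_; _<_; _⊔_; _≡ᵇ_; z≤n; s≤s; s≤s⁻¹)
open import Data.Nat.Properties
open import Data.Nat.DivMod using (_/_; _%_; m*n%n≡0; [m+kn]%n≡m%n; m*n/n≡m; n/1≡n; 0/n≡0; m/n/o≡m/[n*o]; +-distrib-/-∣ʳ)
open import Data.Nat.Divisibility using (divides-refl)
open import Data.Nat.Induction using (<-rec)
open import Data.Bool using (true; false)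
open import Data.Product using (_×_; _,_; ∃; proj₁; proj₂; map; map₂)
open import Data.Fin using (Fin; toℕ; fromℕ<)
open import Data.Fin.Properties using (toℕ-fromℕ<)
open import Data.Fin.Subset using (Subset; Nonempty; ∣_∣; ⁅_⁆; _∈_)
import Data.Fin.Subset as Subset
open import Data.Fin.Subset.Properties using (x∈⁅x⁆; x∈⁅y⁆⇒x≡y; ∣⁅x⁆∣≡1; p⊆q⇒∣p∣≤∣q∣)
open import Relation.Nullary using (contradiction)
open import Function using (_∘_)
open import Relation.Binary.PropositionalEquality

data BinaryView : ℕ → Set where
  zero   : BinaryView 0
  2[1+_] : ∀ q → BinaryView (2 * suc q)
  1+[2_] : ∀ q → BinaryView (suc (2 * q))

binaryView : ∀ m → BinaryView m
binaryView zero = zero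
binaryView (suc m) with binaryView m
... | zero     = 1+[2 0 ]
... | 2[1+ q ] = 1+[2 suc q ]
... | 1+[2 q ] = subst BinaryView (*-suc 2 q) 2[1+ q ]

q<1+[2q] : ∀ q → q < suc (2 * q)
q<1+[2q] q = s≤s (m≤m+n q (q + 0))

1+q<2[1+q] : ∀ q → suc q < 2 * suc q
1+q<2[1+q] q = m<m+n (suc q) (s≤s z≤n)

<-fuel : ∀ {q m f} → q < m → m < suc f → q < f
<-fuel q<m m<F = <-≤-trans q<m (s≤s⁻¹ m<F)

2q%2≡0 : ∀ q → 2 * q % 2 ≡ 0
2q%2≡0 q = trans (cong (_% 2) (*-comm 2 q)) (m*n%n≡0 q 2)

[1+2q]%2≡1 : ∀ q → suc (2 * q) % 2 ≡ 1
[1+2q]%2≡1 q = trans (cong (λ x → suc x % 2) (*-comm 2 q)) ([m+kn]%n≡m%n 1 q 2)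

2q/2≡q : ∀ q → 2 * q / 2 ≡ q
2q/2≡q q = trans (cong (_/ 2) (*-comm 2 q)) (m*n/n≡m q 2)

[1+2q]/2≡q : ∀ q → suc (2 * q) / 2 ≡ q
[1+2q]/2≡q q = begin
  suc (2 * q) / 2    ≡⟨ cong (λ x → suc x / 2) (*-comm 2 q) ⟩
  (1 + q * 2) / 2    ≡⟨ +-distrib-/-∣ʳ 1 {d = 2} (divides-refl q) ⟩
  1 / 2 + q * 2 / 2  ≡⟨ m*n/n≡m q 2 ⟩
  q                  ∎
  where open ≡-Reasoning

zeroBitsF : ℕ → ℕ → ℕ
zeroBitsF zero    m         = 0
zeroBitsF (suc f) zero      = 0
zeroBitsF (suc f) m@(suc _) with m % 2 ≡ᵇ 1
... | true  = zeroBitsF f (m / 2)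
... | false = suc (zeroBitsF f (m / 2))

zeroBits : ℕ → ℕ
zeroBits m = zeroBitsF (suc m) m

zeroBitsF-odd : ∀ f q → zeroBitsF (suc f) (suc (2 * q)) ≡ zeroBitsF f q
zeroBitsF-odd f q rewrite [1+2q]%2≡1 q | [1+2q]/2≡q q = refl

zeroBitsF-even : ∀ f q → zeroBitsF (suc f) (2 * suc q) ≡ suc (zeroBitsF f (suc q))
zeroBitsF-even f q rewrite 2q%2≡0 (suc q) | 2q/2≡q (suc q) = refl

zeroBitsF-fuel : ∀ {F G} m → m < F → m < G → zeroBitsF F m ≡ zeroBitsF G m
zeroBitsF-fuel {suc f} {suc g} m m<F m<G with binaryView m
... | zero     = refl
... | 2[1+ q ] = begin
  zeroBitsF (suc f) (2 * suc q)  ≡⟨ zeroBitsF-even f q ⟩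
  suc (zeroBitsF f (suc q))      ≡⟨ cong suc (zeroBitsF-fuel (suc q) (<-fuel (1+q<2[1+q] q) m<F) (<-fuel (1+q<2[1+q] q) m<G)) ⟩
  suc (zeroBitsF g (suc q))      ≡⟨ zeroBitsF-even g q ⟨
  zeroBitsF (suc g) (2 * suc q)  ∎
  where open ≡-Reasoning
... | 1+[2 q ] = begin
  zeroBitsF (suc f) (suc (2 * q))  ≡⟨ zeroBitsF-odd f q ⟩
  zeroBitsF f q                    ≡⟨ zeroBitsF-fuel q (<-fuel (q<1+[2q] q) m<F) (<-fuel (q<1+[2q] q) m<G) ⟩
  zeroBitsF g q                    ≡⟨ zeroBitsF-odd g q ⟨
  zeroBitsF (suc g) (suc (2 * q))  ∎
  where open ≡-Reasoning

zeroBits-odd : ∀ q → zeroBits (suc (2 * q)) ≡ zeroBits q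
zeroBits-odd q = trans (zeroBitsF-odd (suc (2 * q)) q) (zeroBitsF-fuel q (q<1+[2q] q) ≤-refl)

zeroBits-even : ∀ q → zeroBits (2 * suc q) ≡ suc (zeroBits (suc q))
zeroBits-even q = trans (zeroBitsF-even (2 * suc q) q)
  (cong suc (zeroBitsF-fuel (suc q) (1+q<2[1+q] q) ≤-refl))

zeroBits-double : ∀ q → zeroBits (2 * q) ≤ suc (zeroBits q)
zeroBits-double zero    = z≤n
zeroBits-double (suc q) = ≤-reflexive (zeroBits-even q)

zeroBits-double-pred : ∀ c → zeroBits (2 * c ∸ 1) ≡ zeroBits (c ∸ 1)
zeroBits-double-pred zero    = refl
zeroBits-double-pred (suc c) = trans (cong (λ x → zeroBits (x ∸ 1)) (*-suc 2 c)) (zeroBits-odd c)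

zeroBits-pred : ∀ j → zeroBits j ≤ suc (zeroBits (suc j))
zeroBits-pred = <-rec _ step
  where
  open ≤-Reasoning
  step : ∀ j → (∀ {i} → i < j → zeroBits i ≤ suc (zeroBits (suc i))) → zeroBits j ≤ suc (zeroBits (suc j))
  step j rec with binaryView j
  ... | zero     = z≤n
  ... | 2[1+ q ] = begin
    zeroBits (2 * suc q)              ≤⟨ zeroBits-double (suc q) ⟩
    suc (zeroBits (suc q))            ≡⟨ cong suc (zeroBits-odd (suc q)) ⟨
    suc (zeroBits (suc (2 * suc q)))  ∎
  ... | 1+[2 q ] = begin
    zeroBits (suc (2 * q))            ≡⟨ zeroBits-odd q ⟩
    zeroBits q                        ≤⟨ rec (q<1+[2q] q) ⟩
    suc (zeroBits (suc q))            ≡⟨ zeroBits-even q ⟨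
    zeroBits (2 * suc q)              ≤⟨ n≤1+n _ ⟩
    suc (zeroBits (2 * suc q))        ≡⟨ cong (λ x → suc (zeroBits x)) (*-suc 2 q) ⟩
    suc (zeroBits (suc (suc (2 * q)))) ∎

roundDownTo : ℕ → ℕ → ℕ
roundDownTo z m = 2 ^ z * ((m / 2 ^ z) {{m^n≢0 2 z}})

roundDownTo-zero : ∀ m → roundDownTo 0 m ≡ m
roundDownTo-zero m = trans (*-identityˡ _) (n/1≡n m)

roundDownTo-suc : ∀ z m → roundDownTo (suc z) m ≡ 2 * roundDownTo z (m / 2)
roundDownTo-suc z m = begin
  2 * 2 ^ z * ((m / (2 * 2 ^ z)) {{m^n≢0 2 (suc z)}})
    ≡⟨ cong (2 * 2 ^ z *_) (m/n/o≡m/[n*o] m 2 (2 ^ z) {{_}} {{m^n≢0 2 z}} {{m^n≢0 2 (suc z)}}) ⟨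
  2 * 2 ^ z * (((m / 2) / 2 ^ z) {{m^n≢0 2 z}})
    ≡⟨ *-assoc 2 (2 ^ z) _ ⟩
  2 * roundDownTo z (m / 2) ∎
  where open ≡-Reasoning

roundDownTo-of-zero : ∀ z → roundDownTo z 0 ≡ 0
roundDownTo-of-zero z = trans (cong (2 ^ z *_) (0/n≡0 (2 ^ z) {{m^n≢0 2 z}})) (*-zeroʳ (2 ^ z))

zeroPosF-odd : ∀ f ℓ q → zeroPosF (suc f) ℓ (suc (2 * q)) ≡ suc (zeroPosF f ℓ q)
zeroPosF-odd f ℓ q rewrite [1+2q]%2≡1 q | [1+2q]/2≡q q = refl

zeroPosF-even-one : ∀ f q → zeroPosF (suc f) 1 (2 * q) ≡ 0
zeroPosF-even-one f q rewrite 2q%2≡0 q = refl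

zeroPosF-even : ∀ f ℓ q → zeroPosF (suc f) (suc (suc ℓ)) (2 * q) ≡ suc (zeroPosF f (suc ℓ) q)
zeroPosF-even f ℓ q rewrite 2q%2≡0 q | 2q/2≡q q = refl

clearTailF : ℕ → ℕ → ℕ → ℕ
clearTailF F ℓ m = roundDownTo (zeroPosF F ℓ m) m

clearTail : ℕ → ℕ → ℕ
clearTail ℓ m = clearTailF (suc (m + ℓ)) ℓ m

prune-clearTail : ∀ ℓ m → prune ℓ m ≡ clearTail ℓ m ∸ 1
prune-clearTail ℓ m = refl

clearTail-fuel : ∀ ℓ m → m < suc (m + ℓ)
clearTail-fuel ℓ m = s≤s (m≤m+n m ℓ)

clearTailF-of-zero : ∀ F ℓ → clearTailF F ℓ 0 ≡ 0
clearTailF-of-zero F ℓ = roundDownTo-of-zero (zeroPosF F ℓ 0)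

clearTailF-odd : ∀ f ℓ q → clearTailF (suc f) ℓ (suc (2 * q)) ≡ 2 * clearTailF f ℓ q
clearTailF-odd f ℓ q = begin
  roundDownTo (zeroPosF (suc f) ℓ (suc (2 * q))) (suc (2 * q))
    ≡⟨ cong (λ z → roundDownTo z (suc (2 * q))) (zeroPosF-odd f ℓ q) ⟩
  roundDownTo (suc (zeroPosF f ℓ q)) (suc (2 * q))
    ≡⟨ roundDownTo-suc (zeroPosF f ℓ q) (suc (2 * q)) ⟩
  2 * roundDownTo (zeroPosF f ℓ q) (suc (2 * q) / 2)
    ≡⟨ cong (λ m → 2 * roundDownTo (zeroPosF f ℓ q) m) ([1+2q]/2≡q q) ⟩
  2 * clearTailF f ℓ q ∎
  where open ≡-Reasoning

clearTailF-even-one : ∀ f q → clearTailF (suc f) 1 (2 * q) ≡ 2 * q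
clearTailF-even-one f q =
  trans (cong (λ z → roundDownTo z (2 * q)) (zeroPosF-even-one f q)) (roundDownTo-zero (2 * q))

clearTailF-even : ∀ f ℓ q → clearTailF (suc f) (suc (suc ℓ)) (2 * q) ≡ 2 * clearTailF f (suc ℓ) q
clearTailF-even f ℓ q = begin
  roundDownTo (zeroPosF (suc f) (suc (suc ℓ)) (2 * q)) (2 * q)
    ≡⟨ cong (λ z → roundDownTo z (2 * q)) (zeroPosF-even f ℓ q) ⟩
  roundDownTo (suc (zeroPosF f (suc ℓ) q)) (2 * q)
    ≡⟨ roundDownTo-suc (zeroPosF f (suc ℓ) q) (2 * q) ⟩
  2 * roundDownTo (zeroPosF f (suc ℓ) q) (2 * q / 2)
    ≡⟨ cong (λ m → 2 * roundDownTo (zeroPosF f (suc ℓ) q) m) (2q/2≡q q) ⟩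
  2 * clearTailF f (suc ℓ) q ∎
  where open ≡-Reasoning

zeroBits-clearTailF : ∀ F ℓ m → m < F → clearTailF F (suc ℓ) m ≢ 0 →
  ℓ + zeroBits (clearTailF F (suc ℓ) m ∸ 1) ≤ zeroBits m × suc ℓ ≤ zeroBits m
zeroBits-clearTailF (suc f) ℓ m m<F with binaryView m
... | zero rewrite clearTailF-of-zero (suc f) (suc ℓ) = λ 0≢0 → contradiction refl 0≢0
... | 1+[2 q ] rewrite clearTailF-odd f (suc ℓ) q | zeroBits-odd q
                     | zeroBits-double-pred (clearTailF f (suc ℓ) q) = λ 2c≢0 →
  zeroBits-clearTailF f ℓ q (<-fuel (q<1+[2q] q) m<F) (λ c≡0 → 2c≢0 (cong (2 *_) c≡0))
zeroBits-clearTailF (suc f) zero m m<F | 2[1+ q ]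
  rewrite clearTailF-even-one f (suc q) | zeroBits-double-pred (suc q) | zeroBits-even q =
  λ _ → zeroBits-pred q , s≤s z≤n
zeroBits-clearTailF (suc f) (suc ℓ) m m<F | 2[1+ q ]
  rewrite clearTailF-even f ℓ (suc q) | zeroBits-double-pred (clearTailF f (suc ℓ) (suc q))
        | zeroBits-even q = λ 2c≢0 →
  map s≤s s≤s (zeroBits-clearTailF f ℓ (suc q) (<-fuel (1+q<2[1+q] q) m<F) (λ c≡0 → 2c≢0 (cong (2 *_) c≡0)))

potential : ℕ → ℕ
potential zero    = 0
potential (suc j) = 1 ⊔ zeroBits (suc j)

potential-pred : ∀ j → potential j ≤ suc (potential (suc j))
potential-pred zero    = z≤n
potential-pred (suc j) = ⊔-lub (s≤s z≤n) (≤-trans (zeroBits-pred (suc j)) (s≤s (m≤n⊔m 1 _)))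

potential-prune : ∀ j → suc (potential (prune 2 (suc j))) ≤ potential (suc j)
potential-prune j rewrite prune-clearTail 2 (suc j)
  with clearTail 2 (suc j) | zeroBits-clearTailF (suc (suc j + 2)) 1 (suc j) (clearTail-fuel 2 (suc j))
... | zero        | _      = m≤m⊔n 1 (zeroBits (suc j))
... | suc zero    | _      = m≤m⊔n 1 (zeroBits (suc j))
... | suc (suc c) | bounds with bounds (λ ())
...   | below , many = ≤-trans (⊔-lub many below) (m≤n⊔m 1 _)

memB-⊥ : ∀ {k} j → memB (Subset.⊥ {k}) j ≡ false
memB-⊥ {zero}  j       = refl
memB-⊥ {suc k} zero    = refl
memB-⊥ {suc k} (suc j) = memB-⊥ {k} j

memB-⁅i⁆-i : ∀ {k} (i : Fin k) → memB ⁅ i ⁆ (toℕ i) ≡ true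
memB-⁅i⁆-i Fin.zero    = refl
memB-⁅i⁆-i (Fin.suc i) = memB-⁅i⁆-i i

memB-⁅i⁆-other : ∀ {k} (i : Fin k) j → j ≢ toℕ i → memB ⁅ i ⁆ j ≡ false
memB-⁅i⁆-other         Fin.zero    zero    j≢i = contradiction refl j≢i
memB-⁅i⁆-other {suc k} Fin.zero    (suc j) _   = memB-⊥ {k} j
memB-⁅i⁆-other         (Fin.suc i) zero    _   = refl
memB-⁅i⁆-other         (Fin.suc i) (suc j) j≢i = memB-⁅i⁆-other i j (j≢i ∘ cong suc)

nonempty⇒∣p∣≢0 : ∀ {k} {p : Subset k} → Nonempty p → ∣ p ∣ ≢ 0
nonempty⇒∣p∣≢0 {p = p} (x , x∈p) = n>0⇒n≢0 (subst (_≤ ∣ p ∣) (∣⁅x⁆∣≡1 x) (p⊆q⇒∣p∣≤∣q∣ ⁅x⁆⊆p))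
  where
  ⁅x⁆⊆p : ∀ {y} → y ∈ ⁅ x ⁆ → y ∈ p
  ⁅x⁆⊆p y∈⁅x⁆ = subst (_∈ p) (sym (x∈⁅y⁆⇒x≡y x y∈⁅x⁆)) x∈p

loop-at-zero : ∀ {k} f ℓ (S : Subset k) R C → loop f ℓ S 0 R C ≡ (R , C)
loop-at-zero zero    ℓ S R C = refl
loop-at-zero (suc f) ℓ S R C = refl

loop-hit : ∀ {k} f ℓ (S : Subset k) j R C → memB S (suc j) ≡ true →
  loop (suc f) ℓ S (suc j) R C ≡ loop f ℓ S j (suc R) (suc C)
loop-hit f ℓ S j R C j∈S rewrite j∈S = refl

loop-miss : ∀ {k} f ℓ (S : Subset k) j R C → memB S (suc j) ≡ false →
  loop (suc f) ℓ S (suc j) R C ≡ loop f ℓ S (prune ℓ (suc j)) R (suc C)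
loop-miss f ℓ S j R C j∉S rewrite j∉S = refl

loop-shift : ∀ {k} f ℓ (S : Subset k) j R C → loop f ℓ S j R C ≡ map (R +_) (C +_) (loop f ℓ S j 0 0)
loop-shift zero    ℓ S j       R C = sym (cong₂ _,_ (+-identityʳ R) (+-identityʳ C))
loop-shift (suc f) ℓ S zero    R C = sym (cong₂ _,_ (+-identityʳ R) (+-identityʳ C))
loop-shift (suc f) ℓ S (suc j) R C with memB S (suc j)
... | true  = trans (loop-shift f ℓ S j (suc R) (suc C))
                (trans (suc-inside (loop f ℓ S j 0 0)) (cong (map (R +_) (C +_)) (sym (loop-shift f ℓ S j 1 1))))
  where
  suc-inside : ∀ x → map (suc R +_) (suc C +_) x ≡ map (R +_) (C +_) (map suc suc x)
  suc-inside (r , c) = sym (cong₂ _,_ (+-suc R r) (+-suc C c))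
... | false = trans (loop-shift f ℓ S (prune ℓ (suc j)) R (suc C))
                (trans (suc-inside (loop f ℓ S (prune ℓ (suc j)) 0 0))
                       (cong (map (R +_) (C +_)) (sym (loop-shift f ℓ S (prune ℓ (suc j)) 0 1))))
  where
  suc-inside : ∀ x → map (R +_) (suc C +_) x ≡ map (R +_) (C +_) (map₂ suc x)
  suc-inside (r , c) = cong (R + r ,_) (sym (+-suc C c))

Amortised : ℕ → ℕ × ℕ → Set
Amortised p (r , c) = c ≤ 2 * r + p

amortised-hit : ∀ {p q} x → p ≤ suc q → Amortised p x → Amortised q (map suc suc x)
amortised-hit {p} {q} (r , c) p≤1+q c≤ = begin
  suc c                  ≤⟨ s≤s c≤ ⟩
  suc (2 * r + p)        ≤⟨ s≤s (+-monoʳ-≤ (2 * r) p≤1+q) ⟩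
  suc (2 * r + suc q)    ≡⟨ cong suc (+-suc (2 * r) q) ⟩
  suc (suc (2 * r + q))  ≡⟨ cong (_+ q) (*-suc 2 r) ⟨
  2 * suc r + q          ∎
  where open ≤-Reasoning

amortised-prune : ∀ {p q} x → suc p ≤ q → Amortised p x → Amortised q (map₂ suc x)
amortised-prune {p} {q} (r , c) 1+p≤q c≤ = begin
  suc c            ≤⟨ s≤s c≤ ⟩
  suc (2 * r + p)  ≡⟨ +-suc (2 * r) p ⟨
  2 * r + suc p    ≤⟨ +-monoʳ-≤ (2 * r) 1+p≤q ⟩
  2 * r + q        ∎
  where open ≤-Reasoning

loop-amortised : ∀ {k} f (S : Subset k) j → Amortised (potential j) (loop f 2 S j 0 0)
loop-amortised zero    S j    = z≤n
loop-amortised (suc f) S zero = z≤n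
loop-amortised (suc f) S (suc j) with memB S (suc j)
... | true  rewrite loop-shift f 2 S j 1 1 =
  amortised-hit (loop f 2 S j 0 0) (potential-pred j) (loop-amortised f S j)
... | false rewrite loop-shift f 2 S (prune 2 (suc j)) 0 1 =
  amortised-prune (loop f 2 S (prune 2 (suc j)) 0 0) (potential-prune j) (loop-amortised f S _)

allOnes : ℕ → ℕ
allOnes zero    = 0
allOnes (suc k) = suc (2 * allOnes k)

2^k≡1+allOnes : ∀ k → 2 ^ k ≡ suc (allOnes k)
2^k≡1+allOnes zero    = refl
2^k≡1+allOnes (suc k) = trans (cong (2 *_) (2^k≡1+allOnes k)) (*-suc 2 (allOnes k))

zeroBits-allOnes : ∀ k → zeroBits (allOnes k) ≡ 0
zeroBits-allOnes zero    = refl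
zeroBits-allOnes (suc k) = trans (zeroBits-odd (allOnes k)) (zeroBits-allOnes k)

clearTailF-allOnes : ∀ F ℓ k → allOnes k < F → clearTailF F ℓ (allOnes k) ≡ 0
clearTailF-allOnes F       ℓ zero    _   = clearTailF-of-zero F ℓ
clearTailF-allOnes (suc f) ℓ (suc k) m<F = trans (clearTailF-odd f ℓ (allOnes k))
  (cong (2 *_) (clearTailF-allOnes f ℓ k (<-fuel (q<1+[2q] (allOnes k)) m<F)))

prune-allOnes : ∀ ℓ k → prune ℓ (allOnes k) ≡ 0
prune-allOnes ℓ k = cong (_∸ 1) (clearTailF-allOnes _ ℓ k (clearTail-fuel ℓ (allOnes k)))

prune-2allOnes : ∀ ℓ k → prune (suc (suc ℓ)) (2 * allOnes k) ≡ 0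
prune-2allOnes ℓ k = cong (_∸ 1) (trans (clearTailF-even (2 * a + suc (suc ℓ)) ℓ a)
  (cong (2 *_) (clearTailF-allOnes _ (suc ℓ) k (≤-<-trans (m≤n*m a 2) (m<m+n (2 * a) (s≤s z≤n))))))
  where a = allOnes k

potential-2allOnes : ∀ k → potential (2 * allOnes (suc k)) ≡ 1
potential-2allOnes k = cong (1 ⊔_) (trans (zeroBits-even (2 * allOnes k))
  (cong suc (trans (zeroBits-odd (allOnes k)) (zeroBits-allOnes k))))

E-as-loop : ∀ n ℓ (S : Subset (2 ^ n)) → E n ℓ S ≡ loop (suc (allOnes n)) ℓ S (allOnes n) 0 0
E-as-loop n ℓ S = cong (λ M → loop M ℓ S (M ∸ 1) 0 0) (2^k≡1+allOnes n)

loop-from-top-balanced : ∀ {K} k (S : Subset K) →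
  let x = loop (suc (allOnes (2 + k))) 2 S (allOnes (2 + k)) 0 0 in
  proj₁ x ≢ 0 → proj₂ x ≤ 2 * proj₁ x
loop-from-top-balanced k S R≢0 with memB S (allOnes (2 + k))
... | true  rewrite loop-shift (allOnes (2 + k)) 2 S (2 * allOnes (suc k)) 1 1 =
  ≤-trans (amortised-hit (loop (allOnes (2 + k)) 2 S (2 * allOnes (suc k)) 0 0) (≤-reflexive (potential-2allOnes k))
                         (loop-amortised (allOnes (2 + k)) S (2 * allOnes (suc k))))
          (≤-reflexive (+-identityʳ _))
... | false = contradiction (cong (λ j → proj₁ (loop (allOnes (2 + k)) 2 S j 0 1)) (prune-allOnes 2 (2 + k))) R≢0

loop-top-only : ∀ {K} k (S : Subset K) → memB S (allOnes (2 + k)) ≡ true →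
  memB S (2 * allOnes (suc k)) ≡ false →
  loop (suc (allOnes (2 + k))) 2 S (allOnes (2 + k)) 0 0 ≡ (1 , 2)
loop-top-only k S top∈S below∉S = begin
  loop (suc (allOnes (2 + k))) 2 S (allOnes (2 + k)) 0 0
    ≡⟨ loop-hit (allOnes (2 + k)) 2 S (2 * allOnes (suc k)) 0 0 top∈S ⟩
  loop (allOnes (2 + k)) 2 S (2 * allOnes (suc k)) 1 1
    ≡⟨ loop-miss (2 * allOnes (suc k)) 2 S _ 1 1 below∉S ⟩
  loop (2 * allOnes (suc k)) 2 S (prune 2 (2 * allOnes (suc k))) 1 2
    ≡⟨ cong (λ j → loop (2 * allOnes (suc k)) 2 S j 1 2) (prune-2allOnes 0 (suc k)) ⟩
  loop (2 * allOnes (suc k)) 2 S 0 1 2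
    ≡⟨ loop-at-zero (2 * allOnes (suc k)) 2 S 1 2 ⟩
  (1 , 2) ∎
  where open ≡-Reasoning

E-balanced : ∀ k (S : Subset (2 ^ (2 + k))) →
  proj₁ (E (2 + k) 2 S) ≢ 0 → proj₂ (E (2 + k) 2 S) ≤ 2 * proj₁ (E (2 + k) 2 S)
E-balanced k S rewrite E-as-loop (2 + k) 2 S = loop-from-top-balanced k S

top : ∀ n → Fin (2 ^ n)
top n = fromℕ< (≤-reflexive (sym (2^k≡1+allOnes n)))

toℕ-top : ∀ n → toℕ (top n) ≡ allOnes n
toℕ-top n = toℕ-fromℕ< _

E-singleton-top : ∀ k → E (2 + k) 2 ⁅ top (2 + k) ⁆ ≡ (1 , 2)
E-singleton-top k = trans (E-as-loop (2 + k) 2 ⁅ top (2 + k) ⁆) (loop-top-only k ⁅ top (2 + k) ⁆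
  (subst (λ j → memB ⁅ top (2 + k) ⁆ j ≡ true) (toℕ-top (2 + k)) (memB-⁅i⁆-i (top (2 + k))))
  (memB-⁅i⁆-other (top (2 + k)) _ (λ below≡top → <⇒≢ (n<1+n _) (trans below≡top (toℕ-top (2 + k))))))

mainTheorem3 : ∀ (n : ℕ) → 2 ≤ n →
    (∀ (S : Subset (2 ^ n)) → memB S 0 ≡ false → Nonempty S →
       proj₁ (E n 2 S) ≡ ∣ S ∣ →
       proj₂ (E n 2 S) ≤ 2 * proj₁ (E n 2 S))
  × ∃ (λ (S : Subset (2 ^ n)) → (memB S 0 ≡ false) × Nonempty S ×
       (proj₁ (E n 2 S) ≡ ∣ S ∣) ×
       (proj₂ (E n 2 S) ≡ 2 * proj₁ (E n 2 S)))
mainTheorem3 (suc (suc k)) (s≤s (s≤s z≤n)) =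
    (λ S _ nonempty R≡∣S∣ → E-balanced k S (λ R≡0 → nonempty⇒∣p∣≢0 nonempty (trans (sym R≡∣S∣) R≡0)))
  , ⁅ top n ⁆
  , memB-⁅i⁆-other (top n) 0 (λ 0≡top → 0≢1+n (trans 0≡top (toℕ-top n)))
  , (top n , x∈⁅x⁆ (top n))
  , trans (cong proj₁ run) (sym (∣⁅x⁆∣≡1 (top n)))
  , trans (cong proj₂ run) (cong (2 *_) (sym (cong proj₁ run)))
  where
  n = 2 + k
  run : E n 2 ⁅ top n ⁆ ≡ (1 , 2)
  run = E-singleton-top k
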